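{- Let $A_1=(\mathcal{S}_1,\mathcal{E},\mathcal{I}_1,\mathcal{F}_1,\to_1)$ and $A_2=(\mathcal{S}_2,\mathcal{E},\mathcal{I}_2,\mathcal{F}_2,\to_2)$ be Büchi automata over the same set of events. For $X\subseteq\mathcal{S}_1\times\mathcal{S}_2$ define $$\texttt{fsim}^\texttt{R}_\texttt{delay}(X)\triangleq\mu Y.\ \{(s_1,s_2)\mid s_2\in\mathcal{F}_2\wedge\forall e.\forall s_1\xrightarrow{e}_1 s_1'.\exists s_2\xrightarrow{e}_2 s_2'.\ (s_1',s_2')\in X\}\ \cup\ \{(s_1,s_2)\mid \forall e.\forall s_1\xrightarrow{e}_1 s_1'.\exists s_2\xrightarrow{e}_2 s_2'.\ (s_1',s_2')\in Y\},$$ and $$\texttt{fsim}^\texttt{L}_\texttt{delay}\triangleq\nu X.\ \texttt{fsim}^\texttt{R}_\texttt{delay}(X)\ \cup\ \{(s_1,s_2)\mid s_1\notin\mathcal{F}_1\wedge\forall e.\forall s_1\xrightarrow{e}_1 s_1'.\exists s_2\xrightarrow{e}_2 s_2'.\ (s_1',s_2')\in X\}.$$ Then for every $(s_1,s_2)\in\texttt{fsim}^\texttt{L}_\texttt{delay}$: for every event $e$ and every transition $s_1\xrightarrow{e}_1 s_1'$ there exists a transition $s_2\xrightarrow{e}_2 s_2'$ with $(s_1',s_2')\in\texttt{fsim}^\texttt{L}_\texttt{delay}$.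
   Context: A Büchi automaton $(\mathcal{S},\mathcal{E},\mathcal{I},\mathcal{F},\to)$ consists of a set of states $\mathcal{S}$ (not necessarily finite), a set of events $\mathcal{E}$, initial states $\mathcal{I}\subseteq\mathcal{S}$, accepting states $\mathcal{F}\subseteq\mathcal{S}$, and a labeled transition relation $\to\subseteq\mathcal{S}\times\mathcal{E}\times\mathcal{S}$ (written $s\xrightarrow{e}s'$). $\nu$ and $\mu$ denote greatest and least fixed points of monotone operators on the powerset lattice of $\mathcal{S}_1\times\mathcal{S}_2$. -}

module Defs where

open import Level using (Level; _⊔_) renaming (suc to lsuc)
open import Data.Product using (Σ; _×_; _,_)
open import Data.Sum using (_⊎_)
open import Relation.Nullary using (¬_)

record Buchi {a : Level} (E : Set a) : Set (lsuc a) where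
  field
    State  : Set a
    Init   : State → Set a
    Accept : State → Set a
    Step   : State → E → State → Set a

module FSim {a : Level} {E : Set a} (A₁ A₂ : Buchi E) where
  open Buchi A₁ renaming (State to S₁; Accept to F₁; Step to _⟶₁_)
  open Buchi A₂ renaming (State to S₂; Accept to F₂; Step to _⟶₂_)

  Rel : (ℓ : Level) → Set (a ⊔ lsuc ℓ)
  Rel ℓ = S₁ → S₂ → Set ℓ

  _⊆_ : {ℓ ℓ' : Level} → Rel ℓ → Rel ℓ' → Set (a ⊔ ℓ ⊔ ℓ')
  X ⊆ Y = ∀ s₁ s₂ → X s₁ s₂ → Y s₁ s₂

  Sim : {ℓ : Level} → Rel ℓ → Rel (a ⊔ ℓ)
  Sim X s₁ s₂ = ∀ e s₁' → _⟶₁_ s₁ e s₁' →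
                Σ S₂ λ s₂' → _⟶₂_ s₂ e s₂' × X s₁' s₂'

  -- Greatest fixed point (Knaster–Tarski): union of all post-fixed points.
  ν : {ℓ : Level} → (Rel a → Rel ℓ) → Rel (lsuc a ⊔ ℓ)
  ν F s₁ s₂ = Σ (Rel a) λ X → (X ⊆ F X) × X s₁ s₂

  -- The least fixed point of this monotone operator is given as an inductive
  -- family (the smallest relation closed under the two clauses).
  data fsimR {ℓ : Level} (X : Rel ℓ) : Rel (a ⊔ ℓ) where
    here  : ∀ {s₁ s₂} → F₂ s₂ → Sim X s₁ s₂ → fsimR X s₁ s₂
    there : ∀ {s₁ s₂} → Sim (fsimR X) s₁ s₂ → fsimR X s₁ s₂

  fsimL : Rel (lsuc a)
  fsimL = ν (λ X s₁ s₂ → fsimR X s₁ s₂ ⊎ ((¬ F₁ s₁) × Sim X s₁ s₂))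

{-# OPTIONS --safe #-}
-- With Delay X = fsimR X ∪ (¬ F₁ ∩ Sim X) we have fsimL = ν Delay. Unfolding the least
-- fixed point fsimR X once gives Delay X ⊆ Sim (X ∪ fsimR X). If X is a post-fixed point
-- of Delay then so is X ∪ fsimR X, hence X ∪ fsimR X ⊆ fsimL by coinduction.
-- Applied to any X witnessing membership in fsimL, this yields fsimL ⊆ Sim fsimL.
module Submission where

open import Defs
open import Level using (Level; _⊔_)
open import Data.Product using (Σ; _×_; _,_)
open import Data.Sum using (_⊎_; inj₁; inj₂)
open import Relation.Nullary using (¬_)
open import Function using (case_of_)

module DelaySimulation {a : Level} {E : Set a} (A₁ A₂ : Buchi E) where
  open FSim A₁ A₂
  open Buchi A₁ using () renaming (Accept to F₁)

  _∪_ : {ℓ ℓ' : Level} → Rel ℓ → Rel ℓ' → Rel (ℓ ⊔ ℓ')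
  (X ∪ Y) s₁ s₂ = X s₁ s₂ ⊎ Y s₁ s₂

  ⊆-∪ˡ : {ℓ ℓ' : Level} {X : Rel ℓ} {Y : Rel ℓ'} → X ⊆ (X ∪ Y)
  ⊆-∪ˡ _ _ = inj₁

  ⊆-∪ʳ : {ℓ ℓ' : Level} {X : Rel ℓ} {Y : Rel ℓ'} → Y ⊆ (X ∪ Y)
  ⊆-∪ʳ _ _ = inj₂

  Sim-mono : {ℓ ℓ' : Level} {X : Rel ℓ} {Y : Rel ℓ'} → X ⊆ Y → Sim X ⊆ Sim Y
  Sim-mono X⊆Y s₁ s₂ sim e s₁' step with sim e s₁' step
  ... | s₂' , step₂ , x = s₂' , step₂ , X⊆Y s₁' s₂' x

  fsimR-mono : {ℓ ℓ' : Level} {X : Rel ℓ} {Y : Rel ℓ'} → X ⊆ Y → fsimR X ⊆ fsimR Y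
  fsimR-mono X⊆Y s₁ s₂ (here acc sim) = here acc (Sim-mono X⊆Y s₁ s₂ sim)
  fsimR-mono X⊆Y s₁ s₂ (there sim)    = there λ e s₁' step → case sim e s₁' step of λ where
    (s₂' , step₂ , r) → s₂' , step₂ , fsimR-mono X⊆Y s₁' s₂' r

  fsimR⊆Sim : {ℓ : Level} {X : Rel ℓ} → fsimR X ⊆ Sim (X ∪ fsimR X)
  fsimR⊆Sim s₁ s₂ (here _ sim) = Sim-mono ⊆-∪ˡ s₁ s₂ sim
  fsimR⊆Sim s₁ s₂ (there sim)  = Sim-mono ⊆-∪ʳ s₁ s₂ sim

  Delay : Rel a → Rel a
  Delay X s₁ s₂ = fsimR X s₁ s₂ ⊎ ((¬ F₁ s₁) × Sim X s₁ s₂)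

  Delay-mono : {X Y : Rel a} → X ⊆ Y → Delay X ⊆ Delay Y
  Delay-mono X⊆Y s₁ s₂ (inj₁ r)           = inj₁ (fsimR-mono X⊆Y s₁ s₂ r)
  Delay-mono X⊆Y s₁ s₂ (inj₂ (¬acc , sim)) = inj₂ (¬acc , Sim-mono X⊆Y s₁ s₂ sim)

  Delay⊆Sim : {X : Rel a} → Delay X ⊆ Sim (X ∪ fsimR X)
  Delay⊆Sim s₁ s₂ (inj₁ r)         = fsimR⊆Sim s₁ s₂ r
  Delay⊆Sim s₁ s₂ (inj₂ (_ , sim)) = Sim-mono ⊆-∪ˡ s₁ s₂ sim

  ∪fsimR-postfixed : {X : Rel a} → X ⊆ Delay X → (X ∪ fsimR X) ⊆ Delay (X ∪ fsimR X)
  ∪fsimR-postfixed post s₁ s₂ (inj₁ x) = Delay-mono ⊆-∪ˡ s₁ s₂ (post s₁ s₂ x)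
  ∪fsimR-postfixed post s₁ s₂ (inj₂ r) = inj₁ (fsimR-mono ⊆-∪ˡ s₁ s₂ r)

  fsimL-coinduction : {X : Rel a} → X ⊆ Delay X → X ⊆ fsimL
  fsimL-coinduction post s₁ s₂ x = _ , post , x

  fsimL⊆Sim : fsimL ⊆ Sim fsimL
  fsimL⊆Sim s₁ s₂ (X , post , x) =
    Sim-mono (fsimL-coinduction (∪fsimR-postfixed post)) s₁ s₂ (Delay⊆Sim s₁ s₂ (post s₁ s₂ x))

lemma4p3 : {a : Level} {E : Set a} (A₁ A₂ : Buchi E) →
    let open FSim A₁ A₂ in
    ∀ s₁ s₂ → fsimL s₁ s₂ →
      ∀ e s₁' → Buchi.Step A₁ s₁ e s₁' →
        Σ (Buchi.State A₂) λ s₂' → Buchi.Step A₂ s₂ e s₂' × fsimL s₁' s₂'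
lemma4p3 A₁ A₂ = DelaySimulation.fsimL⊆Sim A₁ A₂
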